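{- For every positive integer $k$, \[\frac{q^k-q^{k+1}}{(q^2;q)_{\infty}}=-q^{k+1}+H_k(q),\] where $H_k(q)$ is a power series in $q$ all of whose coefficients are non-negative.
   Context: $(x;q)_\infty=\prod_{j\geq0}(1-xq^j)$, so $(q^2;q)_\infty=\prod_{j\geq2}(1-q^j)$; identities are of formal power series in $q$. -}

module Defs where

open import Data.Nat using (ℕ; zero; suc; _∸_)
open import Data.Nat.Properties using (_≟_)
open import Data.Integer using (ℤ; _+_; _*_; -_; 0ℤ; 1ℤ)
open import Data.Bool using (if_then_else_)
open import Relation.Nullary.Decidable using (⌊_⌋)

-- Formal power series in q with integer coefficients: n ↦ coefficient of q^n.
PS : Set
PS = ℕ → ℤ

sumUpTo : ℕ → (ℕ → ℤ) → ℤ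
sumUpTo zero    f = f 0
sumUpTo (suc n) f = sumUpTo n f + f (suc n)

_⊕_ : PS → PS → PS
(f ⊕ g) n = f n + g n

⊖_ : PS → PS
(⊖ f) n = - f n

_⊛_ : PS → PS → PS
(f ⊛ g) n = sumUpTo n (λ i → f i * g (n ∸ i))

infixl 6 _⊕_
infixl 7 _⊛_
infix 8 ⊖_

qpow : ℕ → PS
qpow k n = if ⌊ n ≟ k ⌋ then 1ℤ else 0ℤ

one : PS
one = qpow 0

prodFrom2 : ℕ → PS
prodFrom2 zero                = one
prodFrom2 (suc zero)          = one
prodFrom2 (suc (suc m))       = prodFrom2 (suc m) ⊛ (one ⊕ ⊖ qpow (suc (suc m)))

-- (q^2;q)_∞ = ∏_{j≥2} (1 - q^j), as a formal power series: its coefficient of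
-- q^n is the coefficient of q^n in the finite product up to j = n
-- (factors with j > n do not affect the coefficient of q^n).
q2Poch : PS
q2Poch n = prodFrom2 n n

-- 1/(q²;q)_∞ = Σ p₁(n) qⁿ, where p₁(n) counts the partitions of n with no part equal to 1, and
-- H_k = q^k ((1 - q)/(q²;q)_∞ + q).  The coefficient of q^(k+m) in H_k is p₁(m) - p₁(m - 1),
-- corrected by +1 at m = 1 where p₁(1) - p₁(0) = -1, so the theorem amounts to p₁ being
-- nondecreasing from n = 1 on.  This is shown on the truncations G_a = ∏_{j=2}^{a} 1/(1 - q^j),
-- whose coefficients of qⁿ, n ≤ a, are the p₁(n): from G_a = G_{a-1} + q^a G_a one gets, by
-- induction on a, the coefficientwise inequality  q G_a ≤ (1 + q^(a+1)) G_a + q,  and its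
-- coefficient of q^a reads p₁(a - 1) ≤ p₁(a).
module Submission where

open import Defs
open import Data.Nat as ℕ using (ℕ; zero; suc; _∸_; _≤_; _<_; z≤n; s≤s; NonZero)
import Data.Nat.Properties as ℕₚ
open import Data.Nat.DivMod using (_%_; m<n⇒m%n≡m; [m+n]%n≡m%n)
open import Data.Integer using (ℤ; 0ℤ; 1ℤ; +_; _+_; _*_; -_; +≤+) renaming (_≤_ to _≤ℤ_)
import Data.Integer.Properties as ℤₚ
open import Data.Integer.Tactic.RingSolver using (solve-∀)
open import Data.Bool using (true; false; if_then_else_)
open import Data.Product using (Σ; _×_; _,_)
open import Data.Sum using (inj₁; inj₂)
open import Relation.Nullary.Decidable using (⌊_⌋; yes; no; isYes≗does; dec-true; dec-false)
open import Function using (_∘_)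
open import Relation.Binary.PropositionalEquality
import Relation.Binary.Reasoning.Setoid as SetoidReasoning

module ≗-Reasoning = SetoidReasoning (ℕ →-setoid ℤ)

*-nonneg : ∀ {i j} → 0ℤ ≤ℤ i → 0ℤ ≤ℤ j → 0ℤ ≤ℤ i * j
*-nonneg {+ m} {+ n} _ _ rewrite sym (ℤₚ.pos-* m n) = +≤+ z≤n

x≤y+x : ∀ {x y} → 0ℤ ≤ℤ y → x ≤ℤ y + x
x≤y+x {x} {y} 0≤y = subst (_≤ℤ y + x) (ℤₚ.+-identityˡ x) (ℤₚ.+-monoˡ-≤ x 0≤y)

sumUpTo-cong : ∀ n {f g : ℕ → ℤ} → (∀ i → i ≤ n → f i ≡ g i) → sumUpTo n f ≡ sumUpTo n g
sumUpTo-cong zero    f≡g = f≡g 0 z≤n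
sumUpTo-cong (suc n) f≡g =
  cong₂ _+_ (sumUpTo-cong n (λ i i≤n → f≡g i (ℕₚ.m≤n⇒m≤1+n i≤n))) (f≡g (suc n) ℕₚ.≤-refl)

sumUpTo-zero : ∀ n {f : ℕ → ℤ} → (∀ i → i ≤ n → f i ≡ 0ℤ) → sumUpTo n f ≡ 0ℤ
sumUpTo-zero zero    f≡0 = f≡0 0 z≤n
sumUpTo-zero (suc n) f≡0 =
  cong₂ _+_ (sumUpTo-zero n (λ i i≤n → f≡0 i (ℕₚ.m≤n⇒m≤1+n i≤n))) (f≡0 (suc n) ℕₚ.≤-refl)

sumUpTo-+ : ∀ n (f g : ℕ → ℤ) → sumUpTo n (λ i → f i + g i) ≡ sumUpTo n f + sumUpTo n g
sumUpTo-+ zero    f g = refl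
sumUpTo-+ (suc n) f g =
  trans (cong (_+ (f (suc n) + g (suc n))) (sumUpTo-+ n f g))
        (interchange (sumUpTo n f) (sumUpTo n g) (f (suc n)) (g (suc n)))
  where
  interchange : ∀ (a b c d : ℤ) → (a + b) + (c + d) ≡ (a + c) + (b + d)
  interchange = solve-∀

sumUpTo-neg : ∀ n (f : ℕ → ℤ) → sumUpTo n (λ i → - f i) ≡ - sumUpTo n f
sumUpTo-neg zero    f = refl
sumUpTo-neg (suc n) f =
  trans (cong (_+ - f (suc n)) (sumUpTo-neg n f)) (sym (ℤₚ.neg-distrib-+ (sumUpTo n f) (f (suc n))))

sumUpTo-suc : ∀ n (f : ℕ → ℤ) → sumUpTo (suc n) f ≡ f 0 + sumUpTo n (λ i → f (suc i))
sumUpTo-suc zero    f = refl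
sumUpTo-suc (suc n) f = trans (cong (_+ f (suc (suc n))) (sumUpTo-suc n f)) (ℤₚ.+-assoc (f 0) _ _)

sumUpTo-nonneg : ∀ n {f : ℕ → ℤ} → (∀ i → 0ℤ ≤ℤ f i) → 0ℤ ≤ℤ sumUpTo n f
sumUpTo-nonneg zero    0≤f = 0≤f 0
sumUpTo-nonneg (suc n) 0≤f = ℤₚ.+-mono-≤ (sumUpTo-nonneg n 0≤f) (0≤f (suc n))

⊕-congʳ : ∀ F {G G′} → G ≗ G′ → F ⊕ G ≗ F ⊕ G′
⊕-congʳ F G≗G′ n = cong (λ x → F n + x) (G≗G′ n)

⊖-cong : ∀ {F G} → F ≗ G → ⊖ F ≗ ⊖ G
⊖-cong F≗G n = cong -_ (F≗G n)

⊛-congˡ : ∀ {F F′} G → F ≗ F′ → F ⊛ G ≗ F′ ⊛ G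
⊛-congˡ G F≗F′ n = sumUpTo-cong n (λ i _ → cong (_* G (n ∸ i)) (F≗F′ i))

⊛-congʳ : ∀ F {G G′} → G ≗ G′ → F ⊛ G ≗ F ⊛ G′
⊛-congʳ F G≗G′ n = sumUpTo-cong n (λ i _ → cong (F i *_) (G≗G′ (n ∸ i)))

⊛-distribˡ-⊕ : ∀ F G H → F ⊛ (G ⊕ H) ≗ F ⊛ G ⊕ F ⊛ H
⊛-distribˡ-⊕ F G H n =
  trans (sumUpTo-cong n (λ i _ → ℤₚ.*-distribˡ-+ (F i) (G (n ∸ i)) (H (n ∸ i)))) (sumUpTo-+ n _ _)

⊛-distribʳ-⊕ : ∀ F G H → (F ⊕ G) ⊛ H ≗ F ⊛ H ⊕ G ⊛ H
⊛-distribʳ-⊕ F G H n =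
  trans (sumUpTo-cong n (λ i _ → ℤₚ.*-distribʳ-+ (H (n ∸ i)) (F i) (G i))) (sumUpTo-+ n _ _)

⊛-negʳ : ∀ F G → F ⊛ ⊖ G ≗ ⊖ (F ⊛ G)
⊛-negʳ F G n = trans (sumUpTo-cong n (λ i _ → sym (ℤₚ.neg-distribʳ-* (F i) (G (n ∸ i))))) (sumUpTo-neg n _)

⊛-negˡ : ∀ F G → ⊖ F ⊛ G ≗ ⊖ (F ⊛ G)
⊛-negˡ F G n = trans (sumUpTo-cong n (λ i _ → sym (ℤₚ.neg-distribˡ-* (F i) (G (n ∸ i))))) (sumUpTo-neg n _)

⊛-identityʳ : ∀ F → F ⊛ one ≗ F
⊛-identityʳ F zero    = ℤₚ.*-identityʳ (F 0)
⊛-identityʳ F (suc n) = begin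
  sumUpTo n (λ i → F i * one (suc n ∸ i)) + F (suc n) * one (suc n ∸ suc n)
    ≡⟨ cong₂ _+_ (sumUpTo-zero n (λ i i≤n →
                   trans (cong (λ m → F i * one m) (ℕₚ.+-∸-assoc 1 i≤n)) (ℤₚ.*-zeroʳ (F i))))
                 (cong (λ m → F (suc n) * one m) (ℕₚ.n∸n≡0 n)) ⟩
  0ℤ + F (suc n) * 1ℤ
    ≡⟨ trans (ℤₚ.+-identityˡ _) (ℤₚ.*-identityʳ _) ⟩
  F (suc n) ∎
  where open ≡-Reasoning

⊛-nonneg : ∀ {F G} → (∀ n → 0ℤ ≤ℤ F n) → (∀ n → 0ℤ ≤ℤ G n) → ∀ n → 0ℤ ≤ℤ (F ⊛ G) n
⊛-nonneg 0≤F 0≤G n = sumUpTo-nonneg n (λ i → *-nonneg (0≤F i) (0≤G (n ∸ i)))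

shift : ℕ → PS → PS
shift zero    F n       = F n
shift (suc j) F zero    = 0ℤ
shift (suc j) F (suc n) = shift j F n

shift-cong : ∀ j {F G} → F ≗ G → shift j F ≗ shift j G
shift-cong zero    F≗G n       = F≗G n
shift-cong (suc j) F≗G zero    = refl
shift-cong (suc j) F≗G (suc n) = shift-cong j F≗G n

shift-sucˡ : ∀ j F → shift (suc j) F ≗ shift 1 (shift j F)
shift-sucˡ j F zero    = refl
shift-sucˡ j F (suc n) = refl

shift-sucʳ : ∀ j F → shift (suc j) F ≗ shift j (shift 1 F)
shift-sucʳ zero    F n       = refl
shift-sucʳ (suc j) F zero    = refl
shift-sucʳ (suc j) F (suc n) = shift-sucʳ j F n

shift-< : ∀ j F {n} → n < j → shift j F n ≡ 0ℤ
shift-< (suc j) F {zero}  _         = refl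
shift-< (suc j) F {suc n} (s≤s n<j) = shift-< j F n<j

shift-+ : ∀ j F p → shift j F (j ℕ.+ p) ≡ F p
shift-+ zero    F p = refl
shift-+ (suc j) F p = shift-+ j F p

shift-⊕ : ∀ j F G → shift j (F ⊕ G) ≗ shift j F ⊕ shift j G
shift-⊕ zero    F G n       = refl
shift-⊕ (suc j) F G zero    = refl
shift-⊕ (suc j) F G (suc n) = shift-⊕ j F G n

shift-⊖ : ∀ j F → shift j (⊖ F) ≗ ⊖ shift j F
shift-⊖ zero    F n       = refl
shift-⊖ (suc j) F zero    = refl
shift-⊖ (suc j) F (suc n) = shift-⊖ j F n

shift-nonneg : ∀ j {F} → (∀ n → 0ℤ ≤ℤ F n) → ∀ n → 0ℤ ≤ℤ shift j F n
shift-nonneg zero    0≤F n       = 0≤F n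
shift-nonneg (suc j) 0≤F zero    = +≤+ z≤n
shift-nonneg (suc j) 0≤F (suc n) = shift-nonneg j 0≤F n

⊛-shift₁ʳ : ∀ F G → F ⊛ shift 1 G ≗ shift 1 (F ⊛ G)
⊛-shift₁ʳ F G zero    = ℤₚ.*-zeroʳ (F 0)
⊛-shift₁ʳ F G (suc n) = begin
  sumUpTo n (λ i → F i * shift 1 G (suc n ∸ i)) + F (suc n) * shift 1 G (suc n ∸ suc n)
    ≡⟨ cong₂ _+_ (sumUpTo-cong n (λ i i≤n → cong (λ m → F i * shift 1 G m) (ℕₚ.+-∸-assoc 1 i≤n)))
                 (cong (λ m → F (suc n) * shift 1 G m) (ℕₚ.n∸n≡0 n)) ⟩
  (F ⊛ G) n + F (suc n) * 0ℤ
    ≡⟨ cong (λ x → (F ⊛ G) n + x) (ℤₚ.*-zeroʳ (F (suc n))) ⟩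
  (F ⊛ G) n + 0ℤ
    ≡⟨ ℤₚ.+-identityʳ _ ⟩
  (F ⊛ G) n ∎
  where open ≡-Reasoning

⊛-shift₁ˡ : ∀ F G → shift 1 F ⊛ G ≗ shift 1 (F ⊛ G)
⊛-shift₁ˡ F G zero    = refl
⊛-shift₁ˡ F G (suc n) =
  trans (sumUpTo-suc n (λ i → shift 1 F i * G (suc n ∸ i))) (ℤₚ.+-identityˡ _)

⊛-shiftʳ : ∀ j F G → F ⊛ shift j G ≗ shift j (F ⊛ G)
⊛-shiftʳ zero    F G = λ _ → refl
⊛-shiftʳ (suc j) F G = begin
  F ⊛ shift (suc j) G      ≈⟨ ⊛-congʳ F (shift-sucˡ j G) ⟩
  F ⊛ shift 1 (shift j G)  ≈⟨ ⊛-shift₁ʳ F (shift j G) ⟩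
  shift 1 (F ⊛ shift j G)  ≈⟨ shift-cong 1 (⊛-shiftʳ j F G) ⟩
  shift 1 (shift j (F ⊛ G)) ≈⟨ shift-sucˡ j (F ⊛ G) ⟨
  shift (suc j) (F ⊛ G)    ∎
  where open ≗-Reasoning

⊛-shiftˡ : ∀ j F G → shift j F ⊛ G ≗ shift j (F ⊛ G)
⊛-shiftˡ zero    F G = λ _ → refl
⊛-shiftˡ (suc j) F G = begin
  shift (suc j) F ⊛ G      ≈⟨ ⊛-congˡ G (shift-sucˡ j F) ⟩
  shift 1 (shift j F) ⊛ G  ≈⟨ ⊛-shift₁ˡ (shift j F) G ⟩
  shift 1 (shift j F ⊛ G)  ≈⟨ shift-cong 1 (⊛-shiftˡ j F G) ⟩
  shift 1 (shift j (F ⊛ G)) ≈⟨ shift-sucˡ j (F ⊛ G) ⟨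
  shift (suc j) (F ⊛ G)    ∎
  where open ≗-Reasoning

⌊suc≟suc⌋ : ∀ m n → ⌊ suc m ℕₚ.≟ suc n ⌋ ≡ ⌊ m ℕₚ.≟ n ⌋
⌊suc≟suc⌋ m n with m ℕₚ.≟ n
... | yes m≡n = trans (isYes≗does _) (dec-true (suc m ℕₚ.≟ suc n) (cong suc m≡n))
... | no  m≢n = trans (isYes≗does _) (dec-false (suc m ℕₚ.≟ suc n) (m≢n ∘ ℕₚ.suc-injective))

qpow-suc : ∀ j n → qpow (suc j) (suc n) ≡ qpow j n
qpow-suc j n = cong (if_then 1ℤ else 0ℤ) (⌊suc≟suc⌋ n j)

qpow≗shift-one : ∀ j → qpow j ≗ shift j one
qpow≗shift-one zero    n       = refl
qpow≗shift-one (suc j) zero    = refl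
qpow≗shift-one (suc j) (suc n) = trans (qpow-suc j n) (qpow≗shift-one j n)

shift-qpow₁ : ∀ k → shift k (qpow 1) ≗ qpow (suc k)
shift-qpow₁ k n = begin
  shift k (qpow 1) n       ≡⟨ shift-cong k (qpow≗shift-one 1) n ⟩
  shift k (shift 1 one) n  ≡⟨ shift-sucʳ k one n ⟨
  shift (suc k) one n      ≡⟨ qpow≗shift-one (suc k) n ⟨
  qpow (suc k) n           ∎
  where open ≡-Reasoning

qpow-nonneg : ∀ k n → 0ℤ ≤ℤ qpow k n
qpow-nonneg k n with ⌊ n ℕₚ.≟ k ⌋
... | true  = +≤+ z≤n
... | false = +≤+ z≤n

[1-q^_]·_ : ℕ → PS → PS
[1-q^ j ]· F = F ⊕ ⊖ shift j F

infix 8 [1-q^_]·_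

[1-q^]-cong : ∀ j {F G} → F ≗ G → [1-q^ j ]· F ≗ [1-q^ j ]· G
[1-q^]-cong j F≗G n = cong₂ _+_ (F≗G n) (⊖-cong (shift-cong j F≗G) n)

≗-[1-q^]⊕shift : ∀ j F → F ≗ [1-q^ j ]· F ⊕ shift j F
≗-[1-q^]⊕shift j F n = x≡x-y+y (F n) (shift j F n)
  where
  x≡x-y+y : ∀ (x y : ℤ) → x ≡ x + - y + y
  x≡x-y+y = solve-∀

⊛-[1-q^]ʳ : ∀ j F G → F ⊛ [1-q^ j ]· G ≗ [1-q^ j ]· (F ⊛ G)
⊛-[1-q^]ʳ j F G = begin
  F ⊛ (G ⊕ ⊖ shift j G)                ≈⟨ ⊛-distribˡ-⊕ F G (⊖ shift j G) ⟩
  F ⊛ G ⊕ F ⊛ ⊖ shift j G              ≈⟨ ⊕-congʳ (F ⊛ G) (⊛-negʳ F (shift j G)) ⟩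
  F ⊛ G ⊕ ⊖ (F ⊛ shift j G)            ≈⟨ ⊕-congʳ (F ⊛ G) (⊖-cong (⊛-shiftʳ j F G)) ⟩
  [1-q^ j ]· (F ⊛ G)                   ∎
  where open ≗-Reasoning

⊛-[1-q^]ˡ : ∀ j F G → [1-q^ j ]· F ⊛ G ≗ [1-q^ j ]· (F ⊛ G)
⊛-[1-q^]ˡ j F G = begin
  (F ⊕ ⊖ shift j F) ⊛ G                ≈⟨ ⊛-distribʳ-⊕ F (⊖ shift j F) G ⟩
  F ⊛ G ⊕ ⊖ shift j F ⊛ G              ≈⟨ ⊕-congʳ (F ⊛ G) (⊛-negˡ (shift j F) G) ⟩
  F ⊛ G ⊕ ⊖ (shift j F ⊛ G)            ≈⟨ ⊕-congʳ (F ⊛ G) (⊖-cong (⊛-shiftˡ j F G)) ⟩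
  [1-q^ j ]· (F ⊛ G)                   ∎
  where open ≗-Reasoning

⊛-one-minus-qpow : ∀ j F → F ⊛ (one ⊕ ⊖ qpow j) ≗ [1-q^ j ]· F
⊛-one-minus-qpow j F = begin
  F ⊛ (one ⊕ ⊖ qpow j)        ≈⟨ ⊛-congʳ F (⊕-congʳ one (⊖-cong (qpow≗shift-one j))) ⟩
  F ⊛ [1-q^ j ]· one          ≈⟨ ⊛-[1-q^]ʳ j F one ⟩
  [1-q^ j ]· (F ⊛ one)        ≈⟨ [1-q^]-cong j (⊛-identityʳ F) ⟩
  [1-q^ j ]· F                ∎
  where open ≗-Reasoning

-- 1/(1 - q^j) = Σ_m q^(jm)
geometric : (j : ℕ) .{{_ : NonZero j}} → PS
geometric j n = one (n % j)

geometric-nonneg : ∀ j .{{_ : NonZero j}} n → 0ℤ ≤ℤ geometric j n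
geometric-nonneg j n = qpow-nonneg 0 (n % j)

geometric-periodic : ∀ j .{{_ : NonZero j}} p → geometric j (j ℕ.+ p) ≡ geometric j p
geometric-periodic j p = cong one (trans (cong (_% j) (ℕₚ.+-comm j p)) ([m+n]%n≡m%n p j))

[1-q^]·geometric : ∀ j .{{_ : NonZero j}} → [1-q^ j ]· geometric j ≗ one
[1-q^]·geometric (suc j) n with n ℕₚ.<? suc j
... | yes n<1+j = begin
  geometric (suc j) n + - shift (suc j) (geometric (suc j)) n
    ≡⟨ cong₂ (λ r s → one r + - s) (m<n⇒m%n≡m n<1+j) (shift-< (suc j) _ n<1+j) ⟩
  one n + 0ℤ
    ≡⟨ ℤₚ.+-identityʳ (one n) ⟩
  one n ∎
  where open ≡-Reasoning
... | no n≮1+j = subst (λ m → ([1-q^ suc j ]· geometric (suc j)) m ≡ one m)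
                       (ℕₚ.m+[n∸m]≡n (ℕₚ.≮⇒≥ n≮1+j)) (beyond (n ∸ suc j))
  where
  open ≡-Reasoning
  beyond : ∀ p → ([1-q^ suc j ]· geometric (suc j)) (suc j ℕ.+ p) ≡ one (suc j ℕ.+ p)
  beyond p = begin
    geometric (suc j) (suc j ℕ.+ p) + - shift (suc j) (geometric (suc j)) (suc j ℕ.+ p)
      ≡⟨ cong₂ (λ x y → x + - y) (geometric-periodic (suc j) p) (shift-+ (suc j) _ p) ⟩
    geometric (suc j) p + - geometric (suc j) p
      ≡⟨ ℤₚ.+-inverseʳ (geometric (suc j) p) ⟩
    0ℤ ∎

[1-q^]·⊛geometric : ∀ j .{{_ : NonZero j}} F → [1-q^ j ]· (F ⊛ geometric j) ≗ F
[1-q^]·⊛geometric j F = begin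
  [1-q^ j ]· (F ⊛ geometric j)  ≈⟨ ⊛-[1-q^]ʳ j F (geometric j) ⟨
  F ⊛ [1-q^ j ]· geometric j    ≈⟨ ⊛-congʳ F ([1-q^]·geometric j) ⟩
  F ⊛ one                       ≈⟨ ⊛-identityʳ F ⟩
  F                             ∎
  where open ≗-Reasoning

invProdFrom2 : ℕ → PS
invProdFrom2 zero          = one
invProdFrom2 (suc zero)    = one
invProdFrom2 (suc (suc m)) = invProdFrom2 (suc m) ⊛ geometric (suc (suc m))

invProdFrom2-nonneg : ∀ a n → 0ℤ ≤ℤ invProdFrom2 a n
invProdFrom2-nonneg zero          = qpow-nonneg 0
invProdFrom2-nonneg (suc zero)    = qpow-nonneg 0
invProdFrom2-nonneg (suc (suc m)) =
  ⊛-nonneg (invProdFrom2-nonneg (suc m)) (geometric-nonneg (suc (suc m)))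

invProdFrom2-unfold : ∀ m →
  invProdFrom2 (suc (suc m)) ≗ invProdFrom2 (suc m) ⊕ shift (suc (suc m)) (invProdFrom2 (suc (suc m)))
invProdFrom2-unfold m n = trans (≗-[1-q^]⊕shift a G n)
                                (cong (_+ shift a G n) ([1-q^]·⊛geometric a (invProdFrom2 (suc m)) n))
  where
  a = suc (suc m)
  G = invProdFrom2 a

prodFrom2-⊛-invProdFrom2 : ∀ a → prodFrom2 a ⊛ invProdFrom2 a ≗ one
prodFrom2-⊛-invProdFrom2 zero          = ⊛-identityʳ one
prodFrom2-⊛-invProdFrom2 (suc zero)    = ⊛-identityʳ one
prodFrom2-⊛-invProdFrom2 (suc (suc m)) = begin
  prodFrom2 a ⊛ G            ≈⟨ ⊛-congˡ G (⊛-one-minus-qpow a P) ⟩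
  [1-q^ a ]· P ⊛ G           ≈⟨ ⊛-[1-q^]ˡ a P G ⟩
  [1-q^ a ]· (P ⊛ G)         ≈⟨ ⊛-[1-q^]ʳ a P G ⟨
  P ⊛ [1-q^ a ]· G           ≈⟨ ⊛-congʳ P ([1-q^]·⊛geometric a (invProdFrom2 (suc m))) ⟩
  P ⊛ invProdFrom2 (suc m)   ≈⟨ prodFrom2-⊛-invProdFrom2 (suc m) ⟩
  one                        ∎
  where
  open ≗-Reasoning
  a = suc (suc m)
  P = prodFrom2 (suc m)
  G = invProdFrom2 a

coeff-stable : (F : ℕ → PS) → (∀ a n → n ≤ a → F (suc a) n ≡ F a n) → ∀ {a n} → n ≤ a → F a n ≡ F n n
coeff-stable F step {zero}  z≤n = refl
coeff-stable F step {suc a} n≤1+a with ℕₚ.m≤n⇒m<n∨m≡n n≤1+a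
... | inj₁ (s≤s n≤a) = trans (step a _ n≤a) (coeff-stable F step n≤a)
... | inj₂ refl      = refl

prodFrom2-coeff-stable : ∀ {a n} → n ≤ a → prodFrom2 a n ≡ prodFrom2 n n
prodFrom2-coeff-stable = coeff-stable prodFrom2 step
  where
  step : ∀ a n → n ≤ a → prodFrom2 (suc a) n ≡ prodFrom2 a n
  step zero    n _   = refl
  step (suc m) n n≤a = begin
    prodFrom2 (suc (suc m)) n        ≡⟨ ⊛-one-minus-qpow (suc (suc m)) P n ⟩
    P n + - shift (suc (suc m)) P n  ≡⟨ cong (λ x → P n + - x) (shift-< (suc (suc m)) P (s≤s n≤a)) ⟩
    P n + 0ℤ                         ≡⟨ ℤₚ.+-identityʳ (P n) ⟩
    P n                              ∎
    where
    open ≡-Reasoning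
    P = prodFrom2 (suc m)

invProdFrom2-coeff-stable : ∀ {a n} → n ≤ a → invProdFrom2 a n ≡ invProdFrom2 n n
invProdFrom2-coeff-stable = coeff-stable invProdFrom2 step
  where
  step : ∀ a n → n ≤ a → invProdFrom2 (suc a) n ≡ invProdFrom2 a n
  step zero    n _   = refl
  step (suc m) n n≤a = begin
    G n                              ≡⟨ invProdFrom2-unfold m n ⟩
    G′ n + shift (suc (suc m)) G n   ≡⟨ cong (λ x → G′ n + x) (shift-< (suc (suc m)) G (s≤s n≤a)) ⟩
    G′ n + 0ℤ                        ≡⟨ ℤₚ.+-identityʳ (G′ n) ⟩
    G′ n                             ∎
    where
    open ≡-Reasoning
    G = invProdFrom2 (suc (suc m))
    G′ = invProdFrom2 (suc m)

-- 1/(q²;q)_∞: its coefficient of qⁿ is already that of the truncation at a = n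
q2PochInv : PS
q2PochInv n = invProdFrom2 n n

q2Poch-⊛-q2PochInv : q2Poch ⊛ q2PochInv ≗ one
q2Poch-⊛-q2PochInv n = trans
  (sumUpTo-cong n (λ i i≤n → cong₂ _*_ (sym (prodFrom2-coeff-stable i≤n))
                                       (sym (invProdFrom2-coeff-stable (ℕₚ.m∸n≤m n i)))))
  (prodFrom2-⊛-invProdFrom2 n n)

shift₁-invProdFrom2-≤ : ∀ m n →
  shift 1 (invProdFrom2 (suc m)) n
    ≤ℤ invProdFrom2 (suc m) n + shift (suc (suc m)) (invProdFrom2 (suc m)) n + qpow 1 n
shift₁-invProdFrom2-≤ zero n = begin
  shift 1 one n                          ≡⟨ qpow≗shift-one 1 n ⟨
  qpow 1 n                               ≤⟨ x≤y+x (ℤₚ.+-mono-≤ (qpow-nonneg 0 n) (shift-nonneg 2 (qpow-nonneg 0) n)) ⟩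
  one n + shift 2 one n + qpow 1 n       ∎
  where open ℤₚ.≤-Reasoning
shift₁-invProdFrom2-≤ (suc m) n = begin
  shift 1 G n
    ≡⟨ shift₁-G ⟩
  shift 1 G′ n + shift (suc a) G n
    ≤⟨ ℤₚ.+-monoˡ-≤ (shift (suc a) G n) (shift₁-invProdFrom2-≤ m n) ⟩
  G′ n + shift a G′ n + qpow 1 n + shift (suc a) G n
    ≤⟨ x≤y+x (shift-nonneg a (shift-nonneg a (invProdFrom2-nonneg a)) n) ⟩
  shift a (shift a G) n + (G′ n + shift a G′ n + qpow 1 n + shift (suc a) G n)
    ≡⟨ regroup (G′ n) (shift a G′ n) (qpow 1 n) (shift (suc a) G n) (shift a (shift a G) n) ⟩
  G′ n + (shift a G′ n + shift a (shift a G) n) + shift (suc a) G n + qpow 1 n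
    ≡⟨ cong (λ x → x + shift (suc a) G n + qpow 1 n) G≡ ⟨
  G n + shift (suc a) G n + qpow 1 n
    ∎
  where
  open ℤₚ.≤-Reasoning
  a = suc (suc m)
  G = invProdFrom2 a
  G′ = invProdFrom2 (suc m)
  shift₁-G : shift 1 G n ≡ shift 1 G′ n + shift (suc a) G n
  shift₁-G = trans (shift-cong 1 (invProdFrom2-unfold m) n)
             (trans (shift-⊕ 1 G′ (shift a G) n)
                    (cong (λ x → shift 1 G′ n + x) (sym (shift-sucˡ a G n))))
  G≡ : G n ≡ G′ n + (shift a G′ n + shift a (shift a G) n)
  G≡ = trans (invProdFrom2-unfold m n)
             (cong (λ x → G′ n + x)
                   (trans (shift-cong a (invProdFrom2-unfold m) n) (shift-⊕ a G′ (shift a G) n)))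
  regroup : ∀ (x y q z w : ℤ) → w + (x + y + q + z) ≡ x + (y + w) + z + q
  regroup = solve-∀

q2PochInv-mono : ∀ m → q2PochInv (suc m) ≤ℤ q2PochInv (suc (suc m))
q2PochInv-mono m = begin
  invProdFrom2 (suc m) (suc m)                       ≡⟨ invProdFrom2-coeff-stable (ℕₚ.n≤1+n (suc m)) ⟨
  shift 1 G a                                        ≤⟨ shift₁-invProdFrom2-≤ (suc m) a ⟩
  G a + shift (suc a) G a + qpow 1 a                 ≡⟨ cong (λ x → G a + x + qpow 1 a) (shift-< (suc a) G ℕₚ.≤-refl) ⟩
  G a + 0ℤ + 0ℤ                                      ≡⟨ trans (ℤₚ.+-identityʳ _) (ℤₚ.+-identityʳ (G a)) ⟩
  G a                                                ∎
  where
  open ℤₚ.≤-Reasoning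
  a = suc (suc m)
  G = invProdFrom2 a

H₀ : PS
H₀ = [1-q^ 1 ]· q2PochInv ⊕ qpow 1

H₀-nonneg : ∀ n → 0ℤ ≤ℤ H₀ n
H₀-nonneg zero          = +≤+ z≤n
H₀-nonneg (suc zero)    = +≤+ z≤n
H₀-nonneg (suc (suc m)) =
  subst (0ℤ ≤ℤ_) (sym (ℤₚ.+-identityʳ _)) (ℤₚ.i≤j⇒0≤j-i (q2PochInv-mono m))

H₀-identity : [1-q^ 1 ]· one ≗ q2Poch ⊛ (⊖ qpow 1 ⊕ H₀)
H₀-identity = begin
  [1-q^ 1 ]· one                    ≈⟨ [1-q^]-cong 1 q2Poch-⊛-q2PochInv ⟨
  [1-q^ 1 ]· (q2Poch ⊛ q2PochInv)   ≈⟨ ⊛-[1-q^]ʳ 1 q2Poch q2PochInv ⟨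
  q2Poch ⊛ [1-q^ 1 ]· q2PochInv     ≈⟨ ⊛-congʳ q2Poch (λ n → cancel (qpow 1 n) (([1-q^ 1 ]· q2PochInv) n)) ⟩
  q2Poch ⊛ (⊖ qpow 1 ⊕ H₀)          ∎
  where
  open ≗-Reasoning
  cancel : ∀ (q x : ℤ) → x ≡ - q + (x + q)
  cancel = solve-∀

shift-[1-q]·one : ∀ k → shift k ([1-q^ 1 ]· one) ≗ qpow k ⊕ ⊖ qpow (suc k)
shift-[1-q]·one k = begin
  shift k (one ⊕ ⊖ shift 1 one)             ≈⟨ shift-⊕ k one (⊖ shift 1 one) ⟩
  shift k one ⊕ shift k (⊖ shift 1 one)     ≈⟨ ⊕-congʳ (shift k one) (shift-⊖ k (shift 1 one)) ⟩
  shift k one ⊕ ⊖ shift k (shift 1 one)     ≈⟨ ⊕-congʳ (shift k one) (⊖-cong (shift-sucʳ k one)) ⟨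
  shift k one ⊕ ⊖ shift (suc k) one
    ≈⟨ (λ n → cong₂ (λ x y → x + - y) (qpow≗shift-one k n) (qpow≗shift-one (suc k) n)) ⟨
  qpow k ⊕ ⊖ qpow (suc k)                   ∎
  where open ≗-Reasoning

corollary2p2 : (k : ℕ) → 1 ≤ k →
    Σ PS (λ H → ((n : ℕ) → 0ℤ ≤ℤ H n) ×
    ((n : ℕ) → (qpow k ⊕ ⊖ qpow (suc k)) n ≡ (q2Poch ⊛ (⊖ qpow (suc k) ⊕ H)) n))
corollary2p2 k _ = shift k H₀ , shift-nonneg k H₀-nonneg , identity
  where
  open ≗-Reasoning
  identity : qpow k ⊕ ⊖ qpow (suc k) ≗ q2Poch ⊛ (⊖ qpow (suc k) ⊕ shift k H₀)
  identity = begin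
    qpow k ⊕ ⊖ qpow (suc k)                   ≈⟨ shift-[1-q]·one k ⟨
    shift k ([1-q^ 1 ]· one)                  ≈⟨ shift-cong k H₀-identity ⟩
    shift k (q2Poch ⊛ (⊖ qpow 1 ⊕ H₀))        ≈⟨ ⊛-shiftʳ k q2Poch (⊖ qpow 1 ⊕ H₀) ⟨
    q2Poch ⊛ shift k (⊖ qpow 1 ⊕ H₀)          ≈⟨ ⊛-congʳ q2Poch shift-summands ⟩
    q2Poch ⊛ (⊖ qpow (suc k) ⊕ shift k H₀)    ∎
    where
    shift-summands : shift k (⊖ qpow 1 ⊕ H₀) ≗ ⊖ qpow (suc k) ⊕ shift k H₀
    shift-summands n = trans (shift-⊕ k (⊖ qpow 1) H₀ n)
      (cong (_+ shift k H₀ n) (trans (shift-⊖ k (qpow 1) n) (cong -_ (shift-qpow₁ k n))))
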